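{- Let $m,n\ge1$, $q_1,\dots,q_n\in(0,1)$, and let $W=(w_{i\ell})_{i,\ell=1}^{m,n}$ be an $m\times n$ random matrix with independent entries, $w_{i\ell}$ geometrically distributed with parameter $q_\ell$ (i.e. $\mathrm{Prob}(w_{i\ell}=k)=(1-q_\ell)q_\ell^k$, $k\in\mathbb{N}$). Let $\pi\in\mathrm{PP}(m,n)$. Then $$\mathrm{Prob}\big(W=\Phi(\pi)\big)=\prod_{\ell=1}^n(1-q_\ell)^m\,q_\ell^{c_\ell(\pi)},$$ where $c_\ell(\pi)$ is the number of columns of $\pi$ containing $\ell$.
   Context: A plane partition is a matrix $\pi=(\pi_{ij})_{i,j\ge1}$ of nonnegative integers with finitely many nonzero entries, weakly decreasing along rows and down columns. $\mathrm{PP}(m,n)$ denotes the set of plane partitions with at most $m$ nonzero rows and largest entry at most $n$. For a plane partition $\pi$, define $d_{i\ell}:=|\{j:\pi_{ij}=\ell>\pi_{i+1,j}\}|$ for $i,\ell\ge1$, and $\Phi(\pi):=(d_{i\ell})$. For $\pi\in\mathrm{PP}(m,n)$, $\Phi(\pi)$ has nonzero entries only in rows $1,\dots,m$ and columns $1,\dots,n$, and the event $W=\Phi(\pi)$ means $w_{i\ell}=d_{i\ell}$ for all $i\in[1,m]$, $\ell\in[1,n]$.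
   Formalization: The parameters $q_1,\dots,q_n$ of the geometric distributions are rational numbers in (0,1) rather than arbitrary reals. -}

module Defs where

open import Data.Nat using (ℕ; zero; suc; _≤_; _≡ᵇ_; _<ᵇ_)
open import Data.Bool using (Bool; true; false; _∧_; _∨_; if_then_else_)
open import Data.Fin using (Fin; toℕ)
open import Data.Product using (Σ; proj₁)
open import Data.Sum using (_⊎_)
open import Data.Rational using (ℚ; 1ℚ; _*_; _-_)
open import Relation.Binary.PropositionalEquality using (_≡_)

-- Plane partitions.  Positions are 0-based: the paper's π_{ij}
-- (i,j ≥ 1) is `entry (i-1) (j-1)`.  Entry values ℓ are NOT shifted.

record PlanePartition : Set where
  field
    entry  : ℕ → ℕ → ℕ
    rowDec : ∀ i j → entry i (suc j) ≤ entry i j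
    colDec : ∀ i j → entry (suc i) j ≤ entry i j
    finite : Σ ℕ λ N → ∀ i j → (N ≤ i ⊎ N ≤ j) → entry i j ≡ 0

open PlanePartition public

bound : PlanePartition → ℕ
bound π = proj₁ (finite π)

InPP : ℕ → ℕ → PlanePartition → Set
InPP m n π = (∀ i j → m ≤ i → entry π i j ≡ 0) × (∀ i j → entry π i j ≤ n)
  where open import Data.Product using (_×_)

countBelow : ℕ → (ℕ → Bool) → ℕ
countBelow zero    p = 0
countBelow (suc N) p = (if p N then 1 else 0) Data.Nat.+ countBelow N p
  where import Data.Nat

anyBelow : ℕ → (ℕ → Bool) → Bool
anyBelow zero    p = false
anyBelow (suc N) p = p N ∨ anyBelow N p

prodFin : (n : ℕ) → (Fin n → ℚ) → ℚ
prodFin zero    f = 1ℚ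
prodFin (suc n) f = f Fin.zero * prodFin n (λ k → f (Fin.suc k))
  where import Data.Fin as Fin

_^ℚ_ : ℚ → ℕ → ℚ
x ^ℚ zero  = 1ℚ
x ^ℚ suc k = x * (x ^ℚ k)

-- d_{iℓ} = |{ j : π_{ij} = ℓ > π_{i+1,j} }|   (row index i 0-based,
-- value ℓ as in the paper).  Columns j with π_{ij} = ℓ ≥ 1 satisfy
-- j < bound π, so counting over j < bound π counts all of them
-- (the case ℓ = 0 is never used below).
dCount : PlanePartition → ℕ → ℕ → ℕ
dCount π i ℓ = countBelow (bound π)
  (λ j → (entry π i j ≡ᵇ ℓ) ∧ (entry π (suc i) j <ᵇ ℓ))

-- Φ(π) restricted to rows 1..m and columns 1..n, as an m×n matrix:
-- Φ m n π i ℓ = d_{(i+1)(ℓ+1)} for i : Fin m, ℓ : Fin n.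
Φ : (m n : ℕ) → PlanePartition → Fin m → Fin n → ℕ
Φ m n π i ℓ = dCount π (toℕ i) (suc (toℕ ℓ))

cCount : PlanePartition → ℕ → ℕ
cCount π ℓ = countBelow (bound π)
  (λ j → anyBelow (bound π) (λ i → entry π i j ≡ᵇ ℓ))

geomPmf : ℚ → ℕ → ℚ
geomPmf q k = (1ℚ - q) * (q ^ℚ k)

-- For W = (w_{iℓ}) with independent entries, w_{iℓ} ~ Geom(q_ℓ),
-- Prob(W = D) = ∏_{i,ℓ} Prob(w_{iℓ} = D_{iℓ}).
ProbWEq : (m n : ℕ) → (Fin n → ℚ) → (Fin m → Fin n → ℕ) → ℚ
ProbWEq m n q D = prodFin m (λ i → prodFin n (λ ℓ → geomPmf (q ℓ) (D i ℓ)))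

-- Fix a value ℓ ≥ 1. A column of π is weakly decreasing and vanishes from row m on, so if it
-- contains ℓ it leaves ℓ exactly once, at its lowest occurrence; hence Σᵢ d_{iℓ} = c_ℓ(π).
-- Independence makes the probability the product over i and ℓ of (1 - q_ℓ) q_ℓ^{d_{iℓ}};
-- collecting the factors of each ℓ gives (1 - q_ℓ)^m q_ℓ^{Σᵢ d_{iℓ}}.
module Submission where

open import Defs
open import Data.Nat using (ℕ; suc; _≤_)
open import Data.Fin using (Fin; toℕ)
open import Data.Product using (_×_)
open import Data.Rational using (ℚ; 0ℚ; 1ℚ; _<_; _*_; _-_)
open import Relation.Binary.PropositionalEquality using (_≡_)

open import Algebra.Bundles using (CommutativeMonoid)
import Algebra.Properties.CommutativeMonoid.Sum as CommutativeMonoidSum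
import Algebra.Properties.Monoid.Mult as MonoidMult
open import Data.Bool using (Bool; true; false; if_then_else_; _∧_)
open import Data.Empty using (⊥-elim)
open import Data.Fin using (zero; suc; inject₁; fromℕ)
open import Data.Fin.Properties using (toℕ-inject₁; toℕ-fromℕ)
open import Data.Nat using (zero; _+_; _≡ᵇ_; _<ᵇ_; z<s; s<s; _≤′_; ≤′-refl; ≤′-step)
  renaming (_<_ to _<ℕ_)
import Data.Nat.Properties as ℕ
open import Data.Product using (_,_; proj₂)
open import Data.Sum using (inj₁; inj₂)
import Data.Rational.Properties as ℚ
open import Function using (_∘_; flip)
open import Relation.Binary.PropositionalEquality using (refl; sym; trans; cong; cong₂; subst)
open Relation.Binary.PropositionalEquality.≡-Reasoning

module ℕΣ = CommutativeMonoidSum ℕ.+-0-commutativeMonoid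
module ℚΠ = CommutativeMonoidSum ℚ.*-1-commutativeMonoid

indicator : Bool → ℕ
indicator b = if b then 1 else 0

countBelow≡sum : ∀ N p → countBelow N p ≡ ℕΣ.sum (λ (k : Fin N) → indicator (p (toℕ k)))
countBelow≡sum zero    p = refl
countBelow≡sum (suc N) p = begin
  indicator (p N) + countBelow N p
    ≡⟨ ℕ.+-comm (indicator (p N)) _ ⟩
  countBelow N p + indicator (p N)
    ≡⟨ cong₂ _+_ (countBelow≡sum N p) (cong (indicator ∘ p) (sym (toℕ-fromℕ N))) ⟩
  ℕΣ.sum {N} χ + χ (fromℕ N)
    ≡⟨ cong (_+ χ (fromℕ N)) (ℕΣ.sum-cong-≗ {N} (cong (indicator ∘ p) ∘ sym ∘ toℕ-inject₁)) ⟩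
  ℕΣ.sum {N} (χ ∘ inject₁) + χ (fromℕ N)
    ≡⟨ ℕΣ.sum-init-last χ ⟨
  ℕΣ.sum {suc N} χ ∎
  where
  χ : ∀ {M} → Fin M → ℕ
  χ k = indicator (p (toℕ k))

anyBelow-stable : ∀ {K N} (p : ℕ → Bool) → (∀ i → K ≤ i → p i ≡ false) →
  K ≤′ N → anyBelow N p ≡ anyBelow K p
anyBelow-stable p vanish ≤′-refl           = refl
anyBelow-stable {K} {suc N} p vanish (≤′-step K≤′N)
  rewrite vanish N (ℕ.≤′⇒≤ K≤′N) = anyBelow-stable p vanish K≤′N

anyBelow-support-irrelevant : ∀ {K₁ K₂} (p : ℕ → Bool) →
  (∀ i → K₁ ≤ i → p i ≡ false) → (∀ i → K₂ ≤ i → p i ≡ false) →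
  anyBelow K₁ p ≡ anyBelow K₂ p
anyBelow-support-irrelevant {K₁} {K₂} p vanish₁ vanish₂ with ℕ.≤-total K₁ K₂
... | inj₁ K₁≤K₂ = sym (anyBelow-stable p vanish₁ (ℕ.≤⇒≤′ K₁≤K₂))
... | inj₂ K₂≤K₁ = anyBelow-stable p vanish₂ (ℕ.≤⇒≤′ K₂≤K₁)

-- Indexing by the two boolean tests lets `with` rewrite them in the goal.
data Trichotomyᵇ (x y : ℕ) : Bool → Bool → Set where
  tri< : x <ℕ y → Trichotomyᵇ x y false true
  tri≈ : x ≡ y  → Trichotomyᵇ x y true  false
  tri> : y <ℕ x → Trichotomyᵇ x y false false

trichotomyᵇ : ∀ x y → Trichotomyᵇ x y (x ≡ᵇ y) (x <ᵇ y)
trichotomyᵇ zero    zero    = tri≈ refl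
trichotomyᵇ zero    (suc y) = tri< z<s
trichotomyᵇ (suc x) zero    = tri> z<s
trichotomyᵇ (suc x) (suc y) with x ≡ᵇ y | x <ᵇ y | trichotomyᵇ x y
... | _ | _ | tri< x<y = tri< (s<s x<y)
... | _ | _ | tri≈ x≡y = tri≈ (cong suc x≡y)
... | _ | _ | tri> y<x = tri> (s<s y<x)

module Antitone (a : ℕ → ℕ) (antitone : ∀ i → a (suc i) ≤ a i) (ℓ : ℕ) where

  occursBelow : ℕ → Bool
  occursBelow N = anyBelow N (λ i → a i ≡ᵇ ℓ)

  exitsBelow : ℕ → ℕ
  exitsBelow N = countBelow N (λ i → (a i ≡ᵇ ℓ) ∧ (a (suc i) <ᵇ ℓ))

  ¬occursBelow : ∀ N → ℓ <ℕ a N → occursBelow N ≡ false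
  ¬occursBelow zero    ℓ<aN = refl
  ¬occursBelow (suc N) ℓ<a1+N with a N ≡ᵇ ℓ | a N <ᵇ ℓ | trichotomyᵇ (a N) ℓ
  ... | _ | _ | tri< aN<ℓ = ⊥-elim (ℕ.<-asym aN<ℓ (ℕ.<-≤-trans ℓ<a1+N (antitone N)))
  ... | _ | _ | tri≈ aN≡ℓ = ⊥-elim (ℕ.<-irrefl (sym aN≡ℓ) (ℕ.<-≤-trans ℓ<a1+N (antitone N)))
  ... | _ | _ | tri> ℓ<aN = ¬occursBelow N ℓ<aN

  exitsBelow≡ : ∀ N → exitsBelow N ≡ (if a N ≡ᵇ ℓ then 0 else indicator (occursBelow N))
  exitsBelow≡ zero with a 0 ≡ᵇ ℓ
  ... | true  = refl
  ... | false = refl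
  exitsBelow≡ (suc N) rewrite exitsBelow≡ N
    with a N ≡ᵇ ℓ | a N <ᵇ ℓ | trichotomyᵇ (a N) ℓ
       | a (suc N) ≡ᵇ ℓ | a (suc N) <ᵇ ℓ | trichotomyᵇ (a (suc N)) ℓ
  ... | _ | _ | tri< _     | _ | _ | tri< _     = refl
  ... | _ | _ | tri< aN<ℓ  | _ | _ | tri≈ a1+N≡ℓ =
    ⊥-elim (ℕ.≤⇒≯ (antitone N) (subst (a N <ℕ_) (sym a1+N≡ℓ) aN<ℓ))
  ... | _ | _ | tri< aN<ℓ  | _ | _ | tri> ℓ<a1+N =
    ⊥-elim (ℕ.≤⇒≯ (antitone N) (ℕ.<-trans aN<ℓ ℓ<a1+N))
  ... | _ | _ | tri≈ _     | _ | _ | tri< _     = refl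
  ... | _ | _ | tri≈ _     | _ | _ | tri≈ _     = refl
  ... | _ | _ | tri≈ aN≡ℓ  | _ | _ | tri> ℓ<a1+N =
    ⊥-elim (ℕ.≤⇒≯ (antitone N) (subst (_<ℕ a (suc N)) (sym aN≡ℓ) ℓ<a1+N))
  ... | _ | _ | tri> _     | _ | _ | tri< _     = refl
  ... | _ | _ | tri> ℓ<aN  | _ | _ | tri≈ _     = cong indicator (¬occursBelow N ℓ<aN)
  ... | _ | _ | tri> _     | _ | _ | tri> _     = refl

exitsAt : PlanePartition → ℕ → ℕ → ℕ → Bool
exitsAt π ℓ i j = (entry π i j ≡ᵇ ℓ) ∧ (entry π (suc i) j <ᵇ ℓ)

occursInColumn : PlanePartition → ℕ → ℕ → Bool
occursInColumn π ℓ j = anyBelow (bound π) (λ i → entry π i j ≡ᵇ ℓ)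

column-exits-once : ∀ {m} (π : PlanePartition) → (∀ i j → m ≤ i → entry π i j ≡ 0) → ∀ k j →
  countBelow m (λ i → exitsAt π (suc k) i j) ≡ indicator (occursInColumn π (suc k) j)
column-exits-once {m} π vanish k j = begin
  exitsBelow m
    ≡⟨ exitsBelow≡ m ⟩
  (if entry π m j ≡ᵇ suc k then 0 else indicator (occursBelow m))
    ≡⟨ cong (λ x → if x ≡ᵇ suc k then 0 else indicator (occursBelow m)) (vanish m j ℕ.≤-refl) ⟩
  indicator (occursBelow m)
    ≡⟨ cong indicator (anyBelow-support-irrelevant _ (absent (λ i → vanish i j)) (absent finite-support)) ⟩
  indicator (occursBelow (bound π)) ∎
  where
  open Antitone (λ i → entry π i j) (λ i → colDec π i j) (suc k)

  finite-support : ∀ i → bound π ≤ i → entry π i j ≡ 0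
  finite-support i B≤i = proj₂ (finite π) i j (inj₁ B≤i)

  absent : ∀ {K} → (∀ i → K ≤ i → entry π i j ≡ 0) → ∀ i → K ≤ i → (entry π i j ≡ᵇ suc k) ≡ false
  absent zero-from i K≤i = cong (_≡ᵇ suc k) (zero-from i K≤i)

sum-dCount≡cCount : ∀ {m} (π : PlanePartition) → (∀ i j → m ≤ i → entry π i j ≡ 0) → ∀ k →
  ℕΣ.sum (λ (i : Fin m) → dCount π (toℕ i) (suc k)) ≡ cCount π (suc k)
sum-dCount≡cCount {m} π vanish k = begin
  ℕΣ.sum {m} (λ i → countBelow B (exits (toℕ i)))
    ≡⟨ ℕΣ.sum-cong-≗ {m} (λ i → countBelow≡sum B (exits (toℕ i))) ⟩
  ℕΣ.sum {m} (λ i → ℕΣ.sum {B} (λ j → indicator (exits (toℕ i) (toℕ j))))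
    ≡⟨ ℕΣ.∑-comm {m} {B} (λ i j → indicator (exits (toℕ i) (toℕ j))) ⟩
  ℕΣ.sum {B} (λ j → ℕΣ.sum {m} (λ i → indicator (exits (toℕ i) (toℕ j))))
    ≡⟨ ℕΣ.sum-cong-≗ {B} (λ j → countBelow≡sum m (λ i → exits i (toℕ j))) ⟨
  ℕΣ.sum {B} (λ j → countBelow m (λ i → exits i (toℕ j)))
    ≡⟨ ℕΣ.sum-cong-≗ {B} (λ j → column-exits-once π vanish k (toℕ j)) ⟩
  ℕΣ.sum {B} (λ j → indicator (occursInColumn π (suc k) (toℕ j)))
    ≡⟨ countBelow≡sum B (occursInColumn π (suc k)) ⟨
  cCount π (suc k) ∎
  where
  B : ℕ
  B = bound π

  exits : ℕ → ℕ → Bool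
  exits = exitsAt π (suc k)

module _ {c ℓ} (M : CommutativeMonoid c ℓ) where
  open CommutativeMonoid M using (_≈_; _∙_; ∙-cong; ∙-congˡ; monoid)
    renaming (refl to ≈-refl; sym to ≈-sym; trans to ≈-trans)
  open CommutativeMonoidSum M using (sum; ∑-distrib-+; sum-replicate)
  open MonoidMult monoid using (×-homo-+) renaming (_×_ to _×ᴹ_)

  ×-homo-sum : ∀ {m} (d : Fin m → ℕ) x → (ℕΣ.sum d ×ᴹ x) ≈ sum (λ i → d i ×ᴹ x)
  ×-homo-sum {zero}  d x = ≈-refl
  ×-homo-sum {suc m} d x = ≈-trans (×-homo-+ x (d zero) (ℕΣ.sum (d ∘ suc))) (∙-congˡ (×-homo-sum (d ∘ suc) x))

  sum-const∙× : ∀ {m} a (d : Fin m → ℕ) x → sum (λ i → a ∙ (d i ×ᴹ x)) ≈ (m ×ᴹ a) ∙ (ℕΣ.sum d ×ᴹ x)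
  sum-const∙× {m} a d x =
    ≈-trans (∑-distrib-+ (λ _ → a) (λ i → d i ×ᴹ x)) (∙-cong (sum-replicate m) (≈-sym (×-homo-sum d x)))

open MonoidMult (CommutativeMonoid.monoid ℚ.*-1-commutativeMonoid) using () renaming (_×_ to _×ℚ_)

^ℚ≡×ℚ : ∀ x k → x ^ℚ k ≡ (k ×ℚ x)
^ℚ≡×ℚ x zero    = refl
^ℚ≡×ℚ x (suc k) = cong (x *_) (^ℚ≡×ℚ x k)

prodFin≡sum : ∀ n (f : Fin n → ℚ) → prodFin n f ≡ ℚΠ.sum f
prodFin≡sum zero    f = refl
prodFin≡sum (suc n) f = cong (f zero *_) (prodFin≡sum n (f ∘ suc))

prodFin-cong : ∀ n {f g : Fin n → ℚ} → (∀ i → f i ≡ g i) → prodFin n f ≡ prodFin n g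
prodFin-cong zero    f≗g = refl
prodFin-cong (suc n) f≗g = cong₂ _*_ (f≗g zero) (prodFin-cong n (f≗g ∘ suc))

prodFin-comm : ∀ m n (f : Fin m → Fin n → ℚ) →
  prodFin m (λ i → prodFin n (f i)) ≡ prodFin n (λ j → prodFin m (λ i → f i j))
prodFin-comm m n f = begin
  prodFin m (λ i → prodFin n (f i))            ≡⟨ prodFin²≡sum² m n f ⟩
  ℚΠ.sum (λ i → ℚΠ.sum (f i))                 ≡⟨ ℚΠ.∑-comm f ⟩
  ℚΠ.sum (λ j → ℚΠ.sum (λ i → f i j))         ≡⟨ prodFin²≡sum² n m (flip f) ⟨
  prodFin n (λ j → prodFin m (λ i → f i j))   ∎
  where
  prodFin²≡sum² : ∀ m n (f : Fin m → Fin n → ℚ) →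
    prodFin m (λ i → prodFin n (f i)) ≡ ℚΠ.sum (λ i → ℚΠ.sum (f i))
  prodFin²≡sum² m n f = trans (prodFin-cong m (λ i → prodFin≡sum n (f i))) (prodFin≡sum m _)

prodFin-geomPmf : ∀ {m} q (d : Fin m → ℕ) →
  prodFin m (λ i → geomPmf q (d i)) ≡ ((1ℚ - q) ^ℚ m) * (q ^ℚ ℕΣ.sum d)
prodFin-geomPmf {m} q d = begin
  prodFin m (λ i → (1ℚ - q) * (q ^ℚ d i))
    ≡⟨ prodFin≡sum m _ ⟩
  ℚΠ.sum (λ i → (1ℚ - q) * (q ^ℚ d i))
    ≡⟨ ℚΠ.sum-cong-≗ (λ i → cong ((1ℚ - q) *_) (^ℚ≡×ℚ q (d i))) ⟩
  ℚΠ.sum (λ i → (1ℚ - q) * (d i ×ℚ q))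
    ≡⟨ sum-const∙× ℚ.*-1-commutativeMonoid (1ℚ - q) d q ⟩
  (m ×ℚ (1ℚ - q)) * (ℕΣ.sum d ×ℚ q)
    ≡⟨ cong₂ _*_ (^ℚ≡×ℚ (1ℚ - q) m) (^ℚ≡×ℚ q (ℕΣ.sum d)) ⟨
  ((1ℚ - q) ^ℚ m) * (q ^ℚ ℕΣ.sum d) ∎

-- The identity is purely algebraic: the bounds on m, n, q and on the entries of π are not needed.
lemma2p1 : (m n : ℕ) → 1 ≤ m → 1 ≤ n →
    (q : Fin n → ℚ) → (∀ ℓ → (0ℚ < q ℓ) × (q ℓ < 1ℚ)) →
    (π : PlanePartition) → InPP m n π →
    ProbWEq m n q (Φ m n π)
      ≡ prodFin n (λ ℓ → ((1ℚ - q ℓ) ^ℚ m) * (q ℓ ^ℚ cCount π (suc (toℕ ℓ))))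
lemma2p1 m n _ _ q _ π (beyond-m-rows , _) = begin
  ProbWEq m n q (Φ m n π)
    ≡⟨ prodFin-comm m n (λ i ℓ → geomPmf (q ℓ) (Φ m n π i ℓ)) ⟩
  prodFin n (λ ℓ → prodFin m (λ i → geomPmf (q ℓ) (Φ m n π i ℓ)))
    ≡⟨ prodFin-cong n (λ ℓ → prodFin-geomPmf (q ℓ) (λ i → Φ m n π i ℓ)) ⟩
  prodFin n (λ ℓ → ((1ℚ - q ℓ) ^ℚ m) * (q ℓ ^ℚ ℕΣ.sum (λ i → Φ m n π i ℓ)))
    ≡⟨ prodFin-cong n (λ ℓ → cong (λ c → ((1ℚ - q ℓ) ^ℚ m) * (q ℓ ^ℚ c))
                                  (sum-dCount≡cCount π beyond-m-rows (toℕ ℓ))) ⟩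
  prodFin n (λ ℓ → ((1ℚ - q ℓ) ^ℚ m) * (q ℓ ^ℚ cCount π (suc (toℕ ℓ)))) ∎
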